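{- Let $(\mathcal R,X,\mathcal N)$ be a digit system, $\mathcal S\subseteq\mathcal R$, and $\mathcal V$ a set of witnesses of $\mathcal S$ with respect to $(\mathcal R,X,\mathcal N)$. Then all elements of $\mathcal S$ have finite $X$-ary expansions if and only if all elements of $\mathcal V$ have finite $X$-ary expansions.
   Context: Let $\mathcal E$ be a commutative ring with identity, $d\ge1$, $P(x)=p_dx^d+\dots+p_0\in\mathcal E[x]$ with $p_d,p_0$ not zero divisors of $\mathcal E$ and $\mathcal E/(p_0)$ finite, $\mathcal R=\mathcal E[x]/(P)$, $X$ the image of $x$, and $\mathcal N\subset\mathcal R$ a system of coset representatives of $\mathcal R/(X)$; $(\mathcal R,X,\mathcal N)$ is a digit system. $D_{\mathcal N}(A)$ is the unique $e\in\mathcal N$ with $A\equiv e\pmod X$ and $T(A)=\frac{A-D_{\mathcal N}(A)}{X}$ (the unique $B$ with $XB=A-D_{\mathcal N}(A)$). $A$ has a finite $X$-ary expansion if $T^n(A)=0$ for some $n\in\mathbb N$. A set of witnesses of $\mathcal S$ is a set $\mathcal V\subset\mathcal S$ such that (i) every $A\in\mathcal S$ is a finite sum of elements of $\mathcal V$, and (ii) for each $e\in\mathcal N$ and each $v\in\mathcal V$, $T(v+e)\in\mathcal V$. -}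

module Defs where

open import Level using (Level; _⊔_; suc)
open import Algebra.Bundles using (CommutativeRing)
open import Algebra.Morphism.Structures using (module RingMorphisms)
open import Data.Nat using (ℕ; _≤_) renaming (suc to ℕsuc)
open import Data.Fin using (Fin; fromℕ) renaming (zero to fzero)
open import Data.List using (List; []; _∷_; map)
open import Data.List.Relation.Unary.Any using (Any)
open import Data.List.Relation.Unary.All using (All)
open import Data.Product using (Σ; ∃; _×_)
open import Data.Unit.Polymorphic using (⊤)
open import Relation.Unary using (Pred; _⊆_)
import Data.Vec.Functional as VF

module _ {c ℓ} (E : CommutativeRing c ℓ) where
  open CommutativeRing E

  NonZeroDivisor : Carrier → Set (c ⊔ ℓ)
  NonZeroDivisor a = ∀ b → a * b ≈ 0# → b ≈ 0#

  Divides : Carrier → Carrier → Set (c ⊔ ℓ)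
  Divides a b = ∃ λ q → a * q ≈ b

  CongMod : Carrier → Carrier → Carrier → Set (c ⊔ ℓ)
  CongMod m a b = Divides m (a - b)

  FiniteQuotient : Carrier → Set (c ⊔ ℓ)
  FiniteQuotient m = Σ (List Carrier) λ L → ∀ a → Any (λ b → CongMod m a b) L

  sumL : List Carrier → Carrier
  sumL []       = 0#
  sumL (x ∷ xs) = x + sumL xs

-- Polynomials E[x] as coefficient lists (constant term first)

module Poly {c ℓ} (E : CommutativeRing c ℓ) where
  open CommutativeRing E

  Polynomial : Set c
  Polynomial = List Carrier

  _+ₚ_ : Polynomial → Polynomial → Polynomial
  []       +ₚ q        = q
  (a ∷ p)  +ₚ []       = a ∷ p
  (a ∷ p)  +ₚ (b ∷ q)  = (a + b) ∷ (p +ₚ q)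

  _*ₚ_ : Polynomial → Polynomial → Polynomial
  []      *ₚ q = []
  (a ∷ p) *ₚ q = map (a *_) q +ₚ (0# ∷ (p *ₚ q))

  -- equality of polynomials: coefficientwise, trailing zeros ignored
  _≈ₚ_ : Polynomial → Polynomial → Set ℓ
  []      ≈ₚ []      = ⊤
  []      ≈ₚ (b ∷ q) = (0# ≈ b) × ([] ≈ₚ q)
  (a ∷ p) ≈ₚ []      = (a ≈ 0#) × (p ≈ₚ [])
  (a ∷ p) ≈ₚ (b ∷ q) = (a ≈ b) × (p ≈ₚ q)

  _∣ₚ_ : Polynomial → Polynomial → Set (c ⊔ ℓ)
  P ∣ₚ Q = ∃ λ S → (P *ₚ S) ≈ₚ Q

evalAt : ∀ {c ℓ c′ ℓ′} (E : CommutativeRing c ℓ) (R : CommutativeRing c′ ℓ′) →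
         (CommutativeRing.Carrier E → CommutativeRing.Carrier R) →
         CommutativeRing.Carrier R → List (CommutativeRing.Carrier E) →
         CommutativeRing.Carrier R
evalAt E R ι X []      = CommutativeRing.0# R
evalAt E R ι X (a ∷ q) = CommutativeRing._+_ R (ι a) (CommutativeRing._*_ R X (evalAt E R ι X q))

-- Digit systems (R, X, N) with R = E[x]/(P).
-- Since --safe Agda has no quotient types, R is given as a commutative
-- ring together with a ring homomorphism ι : E → R and an element X such
-- that the evaluation map E[x] → R, x ↦ X, is surjective with kernel (P).
-- This is exactly the statement R ≅ E[x]/(P) with X the image of x.

record DigitSystem {c ℓ c′ ℓ′} (ℓN : Level)
                   (E : CommutativeRing c ℓ) (R : CommutativeRing c′ ℓ′)
                   : Set (c ⊔ ℓ ⊔ c′ ⊔ ℓ′ ⊔ suc ℓN) where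
  module E = CommutativeRing E
  module R = CommutativeRing R
  open Poly E
  open RingMorphisms E.rawRing R.rawRing using (IsRingHomomorphism)
  field
    -- the polynomial P = p_d x^d + ... + p_0, d ≥ 1
    d        : ℕ
    1≤d      : 1 ≤ d
    p        : Fin (ℕsuc d) → E.Carrier

  Pcoeffs : Polynomial
  Pcoeffs = VF.toList p

  p₀ : E.Carrier
  p₀ = p fzero

  field
    pd-nzd   : NonZeroDivisor E (p (fromℕ d))
    p0-nzd   : NonZeroDivisor E p₀
    finite   : FiniteQuotient E p₀
    ι        : E.Carrier → R.Carrier
    ι-hom    : IsRingHomomorphism ι
    X        : R.Carrier

  eval : Polynomial → R.Carrier
  eval = evalAt E R ι X

  field
    eval-surj   : ∀ A → ∃ λ Q → eval Q R.≈ A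
    eval-ker→   : ∀ Q → eval Q R.≈ R.0# → Pcoeffs ∣ₚ Q
    eval-ker←   : ∀ Q → Pcoeffs ∣ₚ Q → eval Q R.≈ R.0#
    N        : Pred R.Carrier ℓN
    rep      : ∀ A → Σ R.Carrier λ e → N e × CongMod R X A e
    rep-uniq : ∀ e e′ → N e → N e′ → CongMod R X e e′ → e R.≈ e′

  D : R.Carrier → R.Carrier
  D A = Data.Product.proj₁ (rep A)

  -- T(A) = (A - D_N(A)) / X : the B with X B = A - D_N(A)
  T : R.Carrier → R.Carrier
  T A = Data.Product.proj₁ (Data.Product.proj₂ (Data.Product.proj₂ (rep A)))

  Tⁿ : ℕ → R.Carrier → R.Carrier
  Tⁿ ℕ.zero    A = A
  Tⁿ (ℕ.suc n) A = Tⁿ n (T A)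

  FiniteExpansion : R.Carrier → Set ℓ′
  FiniteExpansion A = ∃ λ n → Tⁿ n A R.≈ R.0#

  record Witnesses {ℓS ℓV} (S : Pred R.Carrier ℓS) (V : Pred R.Carrier ℓV)
                   : Set (c′ ⊔ ℓ′ ⊔ ℓN ⊔ ℓS ⊔ ℓV) where
    field
      V⊆S     : V ⊆ S
      sums    : ∀ A → S A → ∃ λ (vs : List R.Carrier) → All V vs × A R.≈ sumL R vs
      closedT : ∀ e v → N e → V v → V (T (v R.+ e))

module Submission where

open import Defs
open import Algebra.Bundles using (AbelianGroup; CommutativeRing)
open import Relation.Unary using (Pred)
open import Function.Bundles using (_⇔_; mk⇔)
open import Data.Nat using (ℕ; zero; suc)
open import Data.List using (List; []; _∷_; map; tabulate)
import Data.Fin as Fin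
open import Data.List.Relation.Unary.All using (All; []; _∷_)
open import Data.Product using (_×_; _,_; proj₁; proj₂)
open import Data.Unit.Polymorphic using (tt)
open import Algebra.Morphism.Structures using (module RingMorphisms)
import Algebra.Properties.AbelianGroup as AbelianGroupProperties
import Algebra.Properties.Ring as RingProperties
import Relation.Binary.Reasoning.Setoid as SetoidReasoning

-- For "⇐" write A ∈ S as a sum of
-- witnesses; it suffices that w + B is finite whenever w ∈ V and B is
-- finite.  This follows by induction on the length n of the expansion of
-- B from the carry rule
--     T (w + B) ≈ T (w + D B) + T B,
-- because T (w + D B) is again a witness and T B has an expansion of
-- length n - 1.  The carry rule (and the fact that T respects ≈) rests on
-- uniqueness of the decomposition A ≈ e + X t with e ∈ N, which in turn
-- needs that X is not a zero divisor of R = E[x]/(P).  That last fact is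
-- a statement about polynomials: if p₀ is not a zero divisor and P
-- divides x·Q, then P divides Q.

module PolynomialDivision {c ℓ} (E : CommutativeRing c ℓ) where
  open CommutativeRing E hiding (zero)
  open Poly E
  open SetoidReasoning setoid

  coeff : Polynomial → ℕ → Carrier
  coeff []      _       = 0#
  coeff (a ∷ p) zero    = a
  coeff (a ∷ p) (suc n) = coeff p n

  coeff-cong : ∀ p q → p ≈ₚ q → ∀ n → coeff p n ≈ coeff q n
  coeff-cong []      []      _       n       = refl
  coeff-cong []      (b ∷ q) (e , _) zero    = e
  coeff-cong []      (b ∷ q) (_ , r) (suc n) = coeff-cong [] q r n
  coeff-cong (a ∷ p) []      (e , _) zero    = e
  coeff-cong (a ∷ p) []      (_ , r) (suc n) = coeff-cong p [] r n
  coeff-cong (a ∷ p) (b ∷ q) (e , _) zero    = e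
  coeff-cong (a ∷ p) (b ∷ q) (_ , r) (suc n) = coeff-cong p q r n

  ≈ₚ-from-coeff : ∀ p q → (∀ n → coeff p n ≈ coeff q n) → p ≈ₚ q
  ≈ₚ-from-coeff []      []      f = tt
  ≈ₚ-from-coeff []      (b ∷ q) f = f zero , ≈ₚ-from-coeff [] q (λ n → f (suc n))
  ≈ₚ-from-coeff (a ∷ p) []      f = f zero , ≈ₚ-from-coeff p [] (λ n → f (suc n))
  ≈ₚ-from-coeff (a ∷ p) (b ∷ q) f = f zero , ≈ₚ-from-coeff p q (λ n → f (suc n))

  coeff-+ₚ : ∀ p q n → coeff (p +ₚ q) n ≈ coeff p n + coeff q n
  coeff-+ₚ []      q       n       = sym (+-identityˡ _)
  coeff-+ₚ (a ∷ p) []      n       = sym (+-identityʳ _)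
  coeff-+ₚ (a ∷ p) (b ∷ q) zero    = refl
  coeff-+ₚ (a ∷ p) (b ∷ q) (suc n) = coeff-+ₚ p q n

  coeff-*ₚ-[] : ∀ p n → coeff (p *ₚ []) n ≈ 0#
  coeff-*ₚ-[] []      n       = refl
  coeff-*ₚ-[] (a ∷ p) zero    = refl
  coeff-*ₚ-[] (a ∷ p) (suc n) = coeff-*ₚ-[] p n

  *ₚ-shift : ∀ p s q → s ≈ 0# → ∀ m → coeff (p *ₚ (s ∷ q)) m ≈ coeff (0# ∷ (p *ₚ q)) m
  *ₚ-shift []      s q s≈0 zero    = refl
  *ₚ-shift []      s q s≈0 (suc m) = refl
  *ₚ-shift (b ∷ p) s q s≈0 zero    = trans (+-identityʳ _) (trans (*-congˡ s≈0) (zeroʳ b))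
  *ₚ-shift (b ∷ p) s q s≈0 (suc m) = begin
    coeff (map (b *_) q +ₚ (p *ₚ (s ∷ q))) m     ≈⟨ coeff-+ₚ (map (b *_) q) (p *ₚ (s ∷ q)) m ⟩
    coeff (map (b *_) q) m + coeff (p *ₚ (s ∷ q)) m ≈⟨ +-congˡ (*ₚ-shift p s q s≈0 m) ⟩
    coeff (map (b *_) q) m + coeff (0# ∷ (p *ₚ q)) m ≈⟨ coeff-+ₚ (map (b *_) q) (0# ∷ (p *ₚ q)) m ⟨
    coeff ((b ∷ p) *ₚ q) m                       ∎

  ∣ₚ-cancel-x : ∀ a p q → NonZeroDivisor E a → (a ∷ p) ∣ₚ (0# ∷ q) → (a ∷ p) ∣ₚ q
  ∣ₚ-cancel-x a p q _ ([] , P*[]≈xq) = [] , ≈ₚ-from-coeff ((a ∷ p) *ₚ []) q λ n → begin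
    coeff ((a ∷ p) *ₚ []) n       ≈⟨ coeff-*ₚ-[] (a ∷ p) n ⟩
    0#                            ≈⟨ coeff-*ₚ-[] p n ⟨
    coeff ((a ∷ p) *ₚ []) (suc n) ≈⟨ coeff-cong ((a ∷ p) *ₚ []) (0# ∷ q) P*[]≈xq (suc n) ⟩
    coeff q n                     ∎
  ∣ₚ-cancel-x a p q a-nzd ((s ∷ t) , P*S≈xq) = t , ≈ₚ-from-coeff ((a ∷ p) *ₚ t) q λ n → begin
    coeff ((a ∷ p) *ₚ t) n             ≈⟨ *ₚ-shift (a ∷ p) s t s≈0 (suc n) ⟨
    coeff ((a ∷ p) *ₚ (s ∷ t)) (suc n) ≈⟨ coeffs (suc n) ⟩
    coeff q n                          ∎
    where
    coeffs : ∀ n → coeff ((a ∷ p) *ₚ (s ∷ t)) n ≈ coeff (0# ∷ q) n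
    coeffs = coeff-cong ((a ∷ p) *ₚ (s ∷ t)) (0# ∷ q) P*S≈xq
    -- the constant coefficient of P·S is a·s, which must vanish
    s≈0 : s ≈ 0#
    s≈0 = a-nzd s (trans (sym (+-identityʳ _)) (coeffs zero))

module AbelianGroupFacts {a ℓ} (G : AbelianGroup a ℓ) where
  open AbelianGroup G
  open AbelianGroupProperties G using (x≈z//y; //-rightDividesˡ; xyx⁻¹≈y)
  open SetoidReasoning setoid

  add-sub : ∀ x y → x ∙ (y - x) ≈ y
  add-sub x y = trans (comm x (y - x)) (//-rightDividesˡ x y)

  exchange : ∀ {a b c d} → a ∙ b ≈ c ∙ d → a - c ≈ d - b
  exchange {a} {b} {c} {d} h = begin
    a - c             ≈⟨ ∙-congʳ (x≈z//y a b (c ∙ d) h) ⟩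
    (c ∙ d) - b - c   ≈⟨ ∙-congʳ (assoc c d (b ⁻¹)) ⟩
    c ∙ (d - b) - c   ≈⟨ xyx⁻¹≈y c (d - b) ⟩
    d - b             ∎

module DigitMap {c ℓ c′ ℓ′ ℓN} {E : CommutativeRing c ℓ} {R : CommutativeRing c′ ℓ′}
                (DS : DigitSystem ℓN E R) where
  open DigitSystem DS using (p; p₀; p0-nzd; ι; ι-hom; X; eval; eval-surj; eval-ker→; eval-ker←;
                             N; rep; rep-uniq; D; T; Tⁿ; FiniteExpansion; Witnesses)
  open CommutativeRing R hiding (zero)
  open AbelianGroupProperties +-abelianGroup using (x∙y⁻¹≈ε⇒x≈y; x≈y⇒x∙y⁻¹≈ε)
  open AbelianGroupFacts +-abelianGroup using (add-sub; exchange)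
  open RingProperties ring using (x[y-z]≈xy-xz)
  open RingMorphisms (CommutativeRing.rawRing E) rawRing using (module IsRingHomomorphism)
  open PolynomialDivision E using (∣ₚ-cancel-x)
  open SetoidReasoning setoid

  -- X is not a zero divisor of R = E[x]/(P): write b = Q(X); then x·Q lies
  -- in the ideal (P), hence so does Q because p₀ is not a zero divisor
  X-nonZeroDivisor : NonZeroDivisor R X
  X-nonZeroDivisor b Xb≈0 with eval-surj b
  ... | Q , Q[X]≈b = begin
    b       ≈⟨ Q[X]≈b ⟨
    eval Q  ≈⟨ eval-ker← Q (∣ₚ-cancel-x p₀ higher-coeffs Q p0-nzd (eval-ker→ (E.0# ∷ Q) xQ[X]≈0)) ⟩
    0#      ∎
    where
    module E = CommutativeRing E
    -- the coefficients p₁, …, p_d, so that P = p₀ ∷ higher-coeffs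
    higher-coeffs : List E.Carrier
    higher-coeffs = tabulate (λ i → p (Fin.suc i))
    xQ[X]≈0 : eval (E.0# ∷ Q) ≈ 0#
    xQ[X]≈0 = begin
      ι E.0# + X * eval Q ≈⟨ +-cong (IsRingHomomorphism.0#-homo ι-hom) (*-congˡ Q[X]≈b) ⟩
      0# + X * b          ≈⟨ +-identityˡ _ ⟩
      X * b               ≈⟨ Xb≈0 ⟩
      0#                  ∎

  digit-in-N : ∀ A → N (D A)
  digit-in-N A = proj₁ (proj₂ (rep A))

  digit-decomposition : ∀ A → A ≈ D A + X * T A
  digit-decomposition A = sym (begin
    D A + X * T A   ≈⟨ +-congˡ (proj₂ (proj₂ (proj₂ (rep A)))) ⟩
    D A + (A - D A) ≈⟨ add-sub (D A) A ⟩
    A               ∎)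

  -- such a splitting is unique: e + X t ≈ e′ + X t′ with digits e, e′
  -- forces e ≈ e′ (N is a system of representatives mod X) and then
  -- t ≈ t′ (X is not a zero divisor)
  decomposition-unique : ∀ {e e′ t t′} → N e → N e′ → e + X * t ≈ e′ + X * t′ → e ≈ e′ × t ≈ t′
  decomposition-unique {e} {e′} {t} {t′} Ne Ne′ h = e≈e′ , t≈t′
    where
    X[t′-t]≈e-e′ : X * (t′ - t) ≈ e - e′
    X[t′-t]≈e-e′ = trans (x[y-z]≈xy-xz X t′ t) (sym (exchange h))
    e≈e′ : e ≈ e′
    e≈e′ = rep-uniq e e′ Ne Ne′ (t′ - t , X[t′-t]≈e-e′)
    t≈t′ : t ≈ t′
    t≈t′ = sym (x∙y⁻¹≈ε⇒x≈y t′ t (X-nonZeroDivisor (t′ - t) (trans X[t′-t]≈e-e′ (x≈y⇒x∙y⁻¹≈ε e≈e′))))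

  T-unique : ∀ A {e t} → N e → A ≈ e + X * t → T A ≈ t
  T-unique A Ne h = proj₂ (decomposition-unique (digit-in-N A) Ne (trans (sym (digit-decomposition A)) h))

  T-cong : ∀ {A A′} → A ≈ A′ → T A ≈ T A′
  T-cong {A} {A′} A≈A′ = T-unique A (digit-in-N A′) (trans A≈A′ (digit-decomposition A′))

  Tⁿ-cong : ∀ n {A A′} → A ≈ A′ → Tⁿ n A ≈ Tⁿ n A′
  Tⁿ-cong zero    A≈A′ = A≈A′
  Tⁿ-cong (suc n) A≈A′ = Tⁿ-cong n (T-cong A≈A′)

  FiniteExpansion-cong : ∀ {A A′} → A ≈ A′ → FiniteExpansion A → FiniteExpansion A′
  FiniteExpansion-cong A≈A′ (n , TⁿA≈0) = n , trans (Tⁿ-cong n (sym A≈A′)) TⁿA≈0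

  -- the carry rule: adding w to B, the digit D B is absorbed into w
  T-carry : ∀ w B → T (w + B) ≈ T (w + D B) + T B
  T-carry w B = T-unique (w + B) (digit-in-N C) (begin
    w + B                          ≈⟨ +-congˡ (digit-decomposition B) ⟩
    w + (D B + X * T B)            ≈⟨ +-assoc w (D B) (X * T B) ⟨
    C + X * T B                    ≈⟨ +-congʳ (digit-decomposition C) ⟩
    (D C + X * T C) + X * T B      ≈⟨ +-assoc (D C) (X * T C) (X * T B) ⟩
    D C + (X * T C + X * T B)      ≈⟨ +-congˡ (distribˡ X (T C) (T B)) ⟨
    D C + X * (T C + T B)          ∎)
    where
    C : Carrier
    C = w + D B

  module _ {ℓS ℓV} {S : Pred Carrier ℓS} {V : Pred Carrier ℓV} (W : Witnesses S V)
           (V-finite : ∀ v → V v → FiniteExpansion v) where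
    open Witnesses W using (sums; closedT)

    -- a witness plus an element with finite expansion of length n has a
    -- finite expansion; induction on n via the carry rule, since
    -- T (w + D B) is again a witness
    witness-plus-finite : ∀ n {w B} → V w → Tⁿ n B ≈ 0# → FiniteExpansion (w + B)
    witness-plus-finite zero {w} {B} Vw B≈0 =
      FiniteExpansion-cong (sym (trans (+-congˡ B≈0) (+-identityʳ w))) (V-finite w Vw)
    witness-plus-finite (suc n) {w} {B} Vw TⁿTB≈0
      with witness-plus-finite n (closedT (D B) w (digit-in-N B) Vw) TⁿTB≈0
    ... | m , Tᵐ[carry]≈0 = suc m , trans (Tⁿ-cong m (T-carry w B)) Tᵐ[carry]≈0

    sum-finite : ∀ vs → All V vs → FiniteExpansion (sumL R vs)
    sum-finite []       []         = zero , refl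
    sum-finite (v ∷ vs) (Vv ∷ Vvs) with sum-finite vs Vvs
    ... | n , Tⁿsum≈0 = witness-plus-finite n Vv Tⁿsum≈0

    S-finite : ∀ A → S A → FiniteExpansion A
    S-finite A SA with sums A SA
    ... | vs , Vvs , A≈sum = FiniteExpansion-cong (sym A≈sum) (sum-finite vs Vvs)

lemma6p3 : ∀ {c ℓ c′ ℓ′ ℓN ℓS ℓV} {E : CommutativeRing c ℓ} {R : CommutativeRing c′ ℓ′}
    (DS : DigitSystem ℓN E R) (S : Pred (CommutativeRing.Carrier R) ℓS)
    (V : Pred (CommutativeRing.Carrier R) ℓV) →
    DigitSystem.Witnesses DS S V →
    (∀ A → S A → DigitSystem.FiniteExpansion DS A) ⇔ (∀ v → V v → DigitSystem.FiniteExpansion DS v)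
lemma6p3 DS S V W = mk⇔ (λ S-fin v Vv → S-fin v (V⊆S Vv)) (DigitMap.S-finite DS W)
  where open DigitSystem.Witnesses W using (V⊆S)
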